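{- Let $A$ and $I$ be types, let $B$ be a type family over $A$, and let $t:A\to I$ and $s:\sum_{a:A}B(a)\to I$. Suppose that $B(a)$ is $\Pi$-compact for every $a:A$, and that for each $i:I$ the fiber $\mathsf{fib}_t(i):=\sum_{a:A}(t(a)=i)$ has decidable equality. Then for any $i:I$, $u:\mathsf W_{s,t}(i)$, $j:I$, path $p:i=j$ and $v:\mathsf W_{s,t}(j)$, the type \[\mathsf{transport}^{\mathsf W_{s,t}}(p,u)=v\] is decidable.
   Context: The ambient theory is intensional Martin-Löf type theory with function extensionality. A type $Y$ is decidable if $Y+\neg Y$ holds. A type has decidable equality if $x=y$ is decidable for all of its elements $x,y$. A type $X$ is $\Pi$-compact if for every type family $Y$ over $X$ with all $Y(x)$ decidable, $\prod_{x:X}Y(x)$ is decidable. The indexed $\mathsf W$-type $\mathsf W_{s,t}$ is the inductive family over $I$ with the single constructor \[\mathsf{indexedsup}:\prod_{a:A}\Big(\prod_{b:B(a)}\mathsf W_{s,t}(s(a,b))\Big)\to\mathsf W_{s,t}(t(a)).\] -}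

module Defs where

open import Level using (Level; _⊔_; suc)
open import Data.Product using (Σ; _,_)
open import Relation.Nullary using (Dec)
open import Relation.Binary.PropositionalEquality using (_≡_)

HasDecEq : ∀ {ℓ} → Set ℓ → Set ℓ
HasDecEq X = (x y : X) → Dec (x ≡ y)

ΠCompact : ∀ {ℓ} (𝓥 : Level) → Set ℓ → Set (ℓ ⊔ suc 𝓥)
ΠCompact 𝓥 X = (Y : X → Set 𝓥) → ((x : X) → Dec (Y x)) → Dec ((x : X) → Y x)

fib : ∀ {a i} {A : Set a} {I : Set i} → (A → I) → I → Set (a ⊔ i)
fib {A = A} t i = Σ A (λ a → t a ≡ i)

data W {ℓA ℓB ℓI} {A : Set ℓA} (B : A → Set ℓB) {I : Set ℓI}
       (s : Σ A B → I) (t : A → I) : I → Set (ℓA ⊔ ℓB ⊔ ℓI) where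
  indexedsup : (a : A) → ((b : B a) → W B s t (s (a , b))) → W B s t (t a)

module Submission where

-- A tree in W_{s,t}(k) is the same as its root label in fib_t(k) together with its
-- family of subtrees.  Equality of labels is decidable by hypothesis and, by Hedberg,
-- fib_t(k) is then a set, so equal labels reduce equality of trees to equality of the
-- subtree families; that is decided pointwise by induction and globally by Π-compactness
-- of B(a) and function extensionality.  Hence every W_{s,t}(k) has decidable equality,
-- and the theorem is the instance at the tree transport(p, u).

open import Defs
open import Level using (Level; _⊔_)
open import Data.Product using (Σ; _,_)
open import Data.Product.Properties using (,-injectiveˡ; ,-injectiveʳ-UIP)
open import Function using (_∘_)
open import Relation.Nullary using (Dec; yes; no)
open import Relation.Nullary.Decidable using (map′)
open import Relation.Binary.PropositionalEquality
  using (_≡_; refl; sym; trans; subst; cong; cong-app)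
open import Axiom.Extensionality.Propositional using (Extensionality)
open import Axiom.UniquenessOfIdentityProofs using (module Decidable⇒UIP)

≡-dec-Σ-at : ∀ {a b} {A : Set a} {B : A → Set b} → HasDecEq A →
             (x : A) (f : B x) → ((g : B x) → Dec (f ≡ g)) →
             (y : Σ A B) → Dec ((x , f) ≡ y)
≡-dec-Σ-at _≟_ x f f≟ (y , g) with x ≟ y
... | no x≢y   = no (x≢y ∘ ,-injectiveˡ)
... | yes refl =
  map′ (cong (x ,_)) (,-injectiveʳ-UIP (Decidable⇒UIP.≡-irrelevant _≟_)) (f≟ g)

≡-dec-Π : ∀ {a v} {X : Set a} {Y : X → Set v} → Extensionality a v → ΠCompact v X →
          (f g : (x : X) → Y x) → ((x : X) → Dec (f x ≡ g x)) → Dec (f ≡ g)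
≡-dec-Π ext compact f g f≟g with compact (λ x → f x ≡ g x) f≟g
... | yes f≗g = yes (ext f≗g)
... | no ¬f≗g = no (¬f≗g ∘ cong-app)

module _ {ℓA ℓB ℓI : Level} {A : Set ℓA} {I : Set ℓI} {B : A → Set ℓB}
         {s : Σ A B → I} {t : A → I} where

  Children : ∀ {k} → fib t k → Set (ℓA ⊔ ℓB ⊔ ℓI)
  Children (a , _) = (b : B a) → W B s t (s (a , b))

  Node : I → Set (ℓA ⊔ ℓB ⊔ ℓI)
  Node k = Σ (fib t k) Children

  toNode : ∀ {k} → W B s t k → Node k
  toNode (indexedsup a f) = (a , refl) , f

  fromNode : ∀ {k} → Node k → W B s t k
  fromNode ((a , q) , f) = subst (W B s t) q (indexedsup a f)

  fromNode∘toNode : ∀ {k} (w : W B s t k) → fromNode (toNode w) ≡ w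
  fromNode∘toNode (indexedsup a f) = refl

  toNode-injective : ∀ {k} {u v : W B s t k} → toNode u ≡ toNode v → u ≡ v
  toNode-injective {u = u} {v} e =
    trans (sym (fromNode∘toNode u)) (trans (cong fromNode e) (fromNode∘toNode v))

  module _ (ext : Extensionality ℓB (ℓA ⊔ ℓB ⊔ ℓI))
           (compact : (a : A) → ΠCompact (ℓA ⊔ ℓB ⊔ ℓI) (B a))
           (fib≟ : (k : I) → HasDecEq (fib t k)) where

    ≡-dec-W : ∀ {k} → HasDecEq (W B s t k)
    ≡-dec-W (indexedsup a f) v =
      map′ toNode-injective (cong toNode)
        (≡-dec-Σ-at (fib≟ (t a)) (a , refl) f children≟ (toNode v))
      where
      children≟ : (g : Children (a , refl)) → Dec (f ≡ g)
      children≟ g = ≡-dec-Π ext (compact a) f g (λ b → ≡-dec-W (f b) (g b))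

lemma8p29 : ∀ {ℓA ℓB ℓI : Level}
    → Extensionality ℓB (ℓA ⊔ ℓB ⊔ ℓI)
    → (A : Set ℓA) (I : Set ℓI) (B : A → Set ℓB)
    → (t : A → I) (s : Σ A B → I)
    → ((a : A) → ΠCompact (ℓA ⊔ ℓB ⊔ ℓI) (B a))
    → ((i : I) → HasDecEq (fib t i))
    → (i : I) (u : W B s t i) (j : I) (p : i ≡ j) (v : W B s t j)
    → Dec (subst (W B s t) p u ≡ v)
lemma8p29 ext A I B t s compact fib≟ i u j p v =
  ≡-dec-W ext compact fib≟ (subst (W B s t) p u) v
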